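{- Let $p,q,k$ be integers with $q\geq p>k\geq 2$, and let $G$ be the complete bipartite graph $K_{p,q}$. Then \[ \gamma_{\times k,t}(G_I)=2pk+(q-p)(k+1). \]
   Context: All graphs are finite, simple and undirected. For a graph $G$ without isolated vertices, the inflated graph $G_I$ is obtained as follows: each vertex $x_i$ of $G$ of degree $d(x_i)$ is replaced by a clique $X_i\cong K_{d(x_i)}$ whose vertices are labelled $x_ix_j$, one for each neighbour $x_j$ of $x_i$; and each edge $x_ix_j$ of $G$ is replaced by the edge joining $x_ix_j\in X_i$ to $x_jx_i\in X_j$. A set $S\subseteq V(H)$ is a $k$-tuple total dominating set of a graph $H$ if every vertex of $H$ has at least $k$ neighbours in $S$; $\gamma_{\times k,t}(H)$ denotes the minimum cardinality of such a set. -}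

module Defs where

open import Data.Nat using (ℕ; zero; suc; _+_; _≤_; _<ᵇ_)
open import Data.Bool using (Bool; true; false; if_then_else_; _∧_; _∨_; not; _xor_)
open import Data.Fin using (Fin; zero; suc; toℕ; _≟_)
open import Data.Product using (_×_; _,_; ∃; Σ)
open import Relation.Binary.PropositionalEquality using (_≡_)
open import Relation.Nullary.Decidable using (⌊_⌋)

record SimpleGraph (n : ℕ) : Set where
  field
    adj   : Fin n → Fin n → Bool
    sym   : ∀ i j → adj i j ≡ adj j i
    irrefl : ∀ i → adj i i ≡ false
open SimpleGraph public

NoIsolated : ∀ {n} → SimpleGraph n → Set
NoIsolated {n} G = ∀ (i : Fin n) → Σ (Fin n) (λ j → adj G i j ≡ true)

_==_ : ∀ {n} → Fin n → Fin n → Bool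
i == j = ⌊ i ≟ j ⌋

card : ∀ {n} → (Fin n → Bool) → ℕ
card {zero} f = 0
card {suc n} f = (if f zero then 1 else 0) + card (λ i → f (suc i))

card₂ : ∀ {n} → (Fin n → Fin n → Bool) → ℕ
card₂ {zero} f = 0
card₂ {suc n} f = card (f zero) + card₂ (λ i j → f (suc i) (suc j)) + card (λ j → f (suc j) zero)

-- The inflated graph G_I.
-- Its vertices are the ordered pairs (i , j) with x_i x_j an edge of G
-- (vertex "x_i x_j" lies in the clique X_i).

IVertex : ∀ {n} → SimpleGraph n → Fin n → Fin n → Set
IVertex G i j = adj G i j ≡ true

-- adjacency in G_I between (i , j) and (i' , j')
-- * same clique X_i : i = i', j ≠ j'
-- * edge x_i x_j replaced by edge x_i x_j — x_j x_i : i' = j, j' = i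
adjI : ∀ {n} → SimpleGraph n → Fin n → Fin n → Fin n → Fin n → Bool
adjI G i j i' j' =
  adj G i j ∧ adj G i' j' ∧
  ((i == i' ∧ not (j == j')) ∨ (i' == j ∧ j' == i))

IsubsetOK : ∀ {n} → SimpleGraph n → (Fin n → Fin n → Bool) → Set
IsubsetOK G S = ∀ i j → S i j ≡ true → adj G i j ≡ true

cardI : ∀ {n} → (Fin n → Fin n → Bool) → ℕ
cardI S = card₂ S

nbrsInI : ∀ {n} → SimpleGraph n → (Fin n → Fin n → Bool) → Fin n → Fin n → ℕ
nbrsInI G S i j = card₂ (λ i' j' → adjI G i j i' j' ∧ S i' j')

IsKTupleTDS-I : ∀ {n} → SimpleGraph n → ℕ → (Fin n → Fin n → Bool) → Set
IsKTupleTDS-I {n} G k S =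
  IsubsetOK G S × (∀ (i j : Fin n) → IVertex G i j → k ≤ nbrsInI G S i j)

γ×t-I≡ : ∀ {n} → SimpleGraph n → ℕ → ℕ → Set
γ×t-I≡ {n} G k m =
  (Σ (Fin n → Fin n → Bool) (λ S → IsKTupleTDS-I G k S × cardI S ≡ m)) ×
  (∀ (S : Fin n → Fin n → Bool) → IsKTupleTDS-I G k S → m ≤ cardI S)

-- Complete bipartite graph K_{p,q} on Fin (p + q):
-- parts {0..p-1} and {p..p+q-1}.

kpqAdj : (p q : ℕ) → Fin (p + q) → Fin (p + q) → Bool
kpqAdj p q i j = (toℕ i <ᵇ p) xor (toℕ j <ᵇ p)

private
  xor-comm : ∀ a b → a xor b ≡ b xor a
  xor-comm false false = _≡_.refl
  xor-comm false true = _≡_.refl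
  xor-comm true false = _≡_.refl
  xor-comm true true = _≡_.refl
  xor-self : ∀ a → a xor a ≡ false
  xor-self false = _≡_.refl
  xor-self true = _≡_.refl

K : (p q : ℕ) → SimpleGraph (p + q)
K p q = record
  { adj = kpqAdj p q
  ; sym = λ i j → xor-comm (toℕ i <ᵇ p) (toℕ j <ᵇ p)
  ; irrefl = λ i → xor-self (toℕ i <ᵇ p)
  }

module Submission where

-- Key identity, valid in any inflated graph G_I: for S ⊆ V(G_I) with S_i = S ∩ X_i,
--     N_S(x_i x_j) + [x_i x_j ∈ S] = |S_i| + [x_j x_i ∈ S],
-- so S is k-tuple total dominating iff k + [x_i x_j ∈ S] ≤ |S_i| + [x_j x_i ∈ S] on every
-- edge x_i x_j of G ("local domination"). For k ≥ 2 this forces |S_i| ≥ k, and when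
-- |S_i| ≤ k every x_i x_j ∈ S is reciprocated by x_j x_i ∈ S.
-- Lower bound: with sides A, B and t the number of B-cliques holding ≤ k vertices of S,
-- the A-cliques hold ≥ pk and (by reciprocity) ≥ kt vertices, the B-cliques ≥ q(k + 1) − t;
-- arithmetic then gives 2pk + (q − p)(k + 1).
-- Upper bound: split B = B₁ ∪ B₂ with |B₁| = p, choose x_a x_b and x_b x_a for a ∈ A, b ∈ B₁
-- when (a + b) mod p < k, and in each clique of B₂ choose k + 1 vertices facing A. Cliques
-- of A ∪ B₁ hold exactly k reciprocated vertices, those of B₂ hold k + 1.
-- The file develops finite sums, the key identity, local domination, then both bounds.

open import Defs
open import Data.Nat using (ℕ; _+_; _*_; _∸_; _≤_; _<_)
open import Data.Nat using (zero; suc; z≤n; s≤s; _<ᵇ_; _<?_; _≤?_; _⊓_)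
open import Data.Nat.Properties
  using (+-0-commutativeMonoid; +-commutativeSemigroup; +-comm; +-assoc; +-identityʳ;
         +-mono-≤; +-monoˡ-≤; +-monoʳ-≤; +-cancelʳ-≤; +-cancelˡ-≡; *-comm; *-zeroʳ;
         *-identityˡ; *-identityʳ; *-distribˡ-+; *-monoˡ-≤; ≤-refl; ≤-trans; ≤-reflexive;
         ≤-total; m≤m+n; m≤n+m; 1+n≰n; ≰⇒>; ≮⇒≥; <⇒≤; m+[n∸m]≡n; m+n∸m≡n; ⊓-zeroʳ;
         m≥n⇒m⊓n≡n; module ≤-Reasoning)
open import Data.Nat.Tactic.RingSolver using (solve-∀)
open import Algebra.Properties.CommutativeSemigroup +-commutativeSemigroup
  using (x∙yz≈xz∙y; xy∙z≈xz∙y; xy∙z≈x∙zy)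
open import Algebra.Properties.CommutativeMonoid.Sum +-0-commutativeMonoid
  using (sum; sum-syntax; sum-cong-≗; sum-replicate-zero; ∑-distrib-+; ∑-comm)
open import Data.Bool using (Bool; true; false; if_then_else_; _∧_; _∨_; not; _xor_)
open import Data.Bool.Properties using (∧-zeroʳ; ∧-identityʳ; ∨-identityʳ)
open import Data.Fin using (Fin; zero; suc; toℕ; _≟_; _↑ˡ_; _↑ʳ_; fromℕ<)
open import Data.Fin.Properties using (suc-injective; toℕ-↑ˡ; toℕ-↑ʳ; toℕ<n)
open import Data.Product using (Σ; _×_; _,_; proj₁)
open import Data.Sum using (inj₁; inj₂)
open import Data.Empty using (⊥-elim)
open import Function using (_∘_)
open import Relation.Binary.PropositionalEquality
  using (_≡_; _≢_; refl; trans; cong; cong₂; subst; module ≡-Reasoning)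
  renaming (sym to ≡-sym)
open import Relation.Nullary.Decidable using (yes; no; isYes; isYes≗does; dec-true; dec-false)

𝟙 : Bool → ℕ
𝟙 b = if b then 1 else 0

𝟙≤1 : ∀ b → 𝟙 b ≤ 1
𝟙≤1 true  = s≤s z≤n
𝟙≤1 false = z≤n

sum-mono : ∀ {n} {f g : Fin n → ℕ} → (∀ i → f i ≤ g i) → sum f ≤ sum g
sum-mono {zero}  f≤g = z≤n
sum-mono {suc n} f≤g = +-mono-≤ (f≤g zero) (sum-mono (f≤g ∘ suc))

sum-const : ∀ n (c : ℕ) → ∑[ i < n ] c ≡ n * c
sum-const zero    c = refl
sum-const (suc n) c = cong (c +_) (sum-const n c)

sum-zero : ∀ {n} {f : Fin n → ℕ} → (∀ i → f i ≡ 0) → sum f ≡ 0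
sum-zero {n} f≡0 = trans (sum-cong-≗ f≡0) (sum-replicate-zero n)

sum-scale : ∀ {n} (c : ℕ) (f : Fin n → ℕ) → ∑[ i < n ] (c * f i) ≡ c * sum f
sum-scale {zero}  c f = ≡-sym (*-zeroʳ c)
sum-scale {suc n} c f =
  trans (cong (c * f zero +_) (sum-scale c (f ∘ suc))) (≡-sym (*-distribˡ-+ c (f zero) _))

sum-split : ∀ m {n} (f : Fin (m + n) → ℕ) →
  sum f ≡ ∑[ i < m ] f (i ↑ˡ n) + ∑[ i < n ] f (m ↑ʳ i)
sum-split zero    f = refl
sum-split (suc m) f = trans (cong (f zero +_) (sum-split m (f ∘ suc))) (≡-sym (+-assoc (f zero) _ _))

sum-pick : ∀ {n} (a : Fin n) (f : Fin n → ℕ) → (∀ l → l ≢ a → f l ≡ 0) → sum f ≡ f a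
sum-pick {suc n} zero    f off = trans (cong (f zero +_) (sum-zero (λ l → off (suc l) λ ()))) (+-identityʳ _)
sum-pick {suc n} (suc a) f off = trans (cong (_+ sum (f ∘ suc)) (off zero λ ()))
  (sum-pick a (f ∘ suc) (λ l l≢a → off (suc l) (l≢a ∘ suc-injective)))

card≡sum : ∀ {n} (f : Fin n → Bool) → card f ≡ ∑[ i < n ] 𝟙 (f i)
card≡sum {zero}  f = refl
card≡sum {suc n} f = cong (𝟙 (f zero) +_) (card≡sum (f ∘ suc))

card₂≡sum : ∀ {n} (f : Fin n → Fin n → Bool) → card₂ f ≡ ∑[ i < n ] card (f i)
card₂≡sum {zero}  f = refl
card₂≡sum {suc n} f = begin
    card (f zero) + card₂ (λ i j → f (suc i) (suc j)) + card (λ i → f (suc i) zero)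
      ≡⟨ xy∙z≈x∙zy (card (f zero)) _ _ ⟩
    card (f zero) + (card (λ i → f (suc i) zero) + card₂ (λ i j → f (suc i) (suc j)))
      ≡⟨ cong (card (f zero) +_) (cong₂ _+_ (card≡sum (λ i → f (suc i) zero)) (card₂≡sum (λ i j → f (suc i) (suc j)))) ⟩
    card (f zero) + (∑[ i < n ] 𝟙 (f (suc i) zero) + ∑[ i < n ] card (f (suc i) ∘ suc))
      ≡⟨ cong (card (f zero) +_) (≡-sym (∑-distrib-+ (λ i → 𝟙 (f (suc i) zero)) (λ i → card (f (suc i) ∘ suc)))) ⟩
    card (f zero) + ∑[ i < n ] card (f (suc i)) ∎
  where open ≡-Reasoning

card-false : ∀ {n} → card {n} (λ _ → false) ≡ 0
card-false {n} = trans (card≡sum {n} (λ _ → false)) (sum-zero {n} (λ _ → refl))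

card-witness : ∀ {n} (f : Fin n → Bool) → 1 ≤ card f → Σ (Fin n) (λ j → f j ≡ true)
card-witness {suc n} f 1≤card with f zero in f0
... | true  = zero , f0
... | false with card-witness (f ∘ suc) 1≤card
...   | j , fj = suc j , fj

==-refl : ∀ {n} (i : Fin n) → (i == i) ≡ true
==-refl i = trans (isYes≗does (i ≟ i)) (dec-true (i ≟ i) refl)

==-false : ∀ {n} {i j : Fin n} → i ≢ j → (i == j) ≡ false
==-false {i = i} {j} i≢j = trans (isYes≗does (i ≟ j)) (dec-false (i ≟ j) i≢j)

Selects : ∀ {n} → Fin n → (Fin n → Bool) → Set
Selects a sel = sel a ≡ true × (∀ l → l ≢ a → sel l ≡ false)

selectsˡ : ∀ {n} (a : Fin n) → Selects a (a ==_)
selectsˡ a = ==-refl a , λ l l≢a → ==-false (λ a≡l → l≢a (≡-sym a≡l))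

selectsʳ : ∀ {n} (a : Fin n) → Selects a (_== a)
selectsʳ a = ==-refl a , λ l l≢a → ==-false l≢a

pick-𝟙 : ∀ {n} {a : Fin n} {sel : Fin n → Bool} → Selects a sel →
  (h : Fin n → Bool) → ∑[ l < n ] 𝟙 (sel l ∧ h l) ≡ 𝟙 (h a)
pick-𝟙 {a = a} (at-a , off) h =
  trans (sum-pick a _ (λ l l≢a → cong (λ b → 𝟙 (b ∧ h l)) (off l l≢a)))
        (cong (λ b → 𝟙 (b ∧ h a)) at-a)

pick-card : ∀ {n} {a : Fin n} {sel : Fin n → Bool} → Selects a sel →
  (h : Fin n → Fin n → Bool) → ∑[ l < n ] card (λ m → sel l ∧ h l m) ≡ card (h a)
pick-card {n} {a = a} (at-a , off) h =
  trans (sum-pick a _ (λ l l≢a → trans (cong (λ b → card (λ m → b ∧ h l m)) (off l l≢a)) (card-false {n})))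
        (cong (λ b → card (λ m → b ∧ h a m)) at-a)

𝟙-split : ∀ c s → 𝟙 s ≡ 𝟙 (not c ∧ s) + 𝟙 (c ∧ s)
𝟙-split true  s     = refl
𝟙-split false true  = refl
𝟙-split false false = refl

card-remove : ∀ {n} (j : Fin n) (f : Fin n → Bool) →
  card f ≡ card (λ l → not (j == l) ∧ f l) + 𝟙 (f j)
card-remove {n} j f = begin
    card f                                                       ≡⟨ card≡sum f ⟩
    ∑[ l < n ] 𝟙 (f l)                                           ≡⟨ sum-cong-≗ (λ l → 𝟙-split (j == l) (f l)) ⟩
    ∑[ l < n ] (𝟙 (not (j == l) ∧ f l) + 𝟙 ((j == l) ∧ f l))
      ≡⟨ ∑-distrib-+ (λ l → 𝟙 (not (j == l) ∧ f l)) (λ l → 𝟙 ((j == l) ∧ f l)) ⟩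
    ∑[ l < n ] 𝟙 (not (j == l) ∧ f l) + ∑[ l < n ] 𝟙 ((j == l) ∧ f l)
      ≡⟨ cong₂ _+_ (≡-sym (card≡sum (λ l → not (j == l) ∧ f l))) (pick-𝟙 (selectsˡ j) f) ⟩
    card (λ l → not (j == l) ∧ f l) + 𝟙 (f j)                   ∎
  where open ≡-Reasoning

module _ {n} (G : SimpleGraph n) (S : Fin n → Fin n → Bool) (S⊆V : IsubsetOK G S)
         {i j : Fin n} (ij : IVertex G i j) where

  private
    i≢j : i ≢ j
    i≢j i≡j with trans (≡-sym (irrefl G i)) (trans (cong (adj G i) i≡j) ij)
    ... | ()

  -- x_i' x_j' is an S-neighbour of x_i x_j iff it lies in S and either lies in the clique X_i
  -- (other than x_i x_j) or is the vertex x_j x_i; the two cases are exclusive since i ≢ j.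
  nbr-indicator : ∀ i' j' → 𝟙 (adjI G i j i' j' ∧ S i' j')
    ≡ 𝟙 ((i == i') ∧ (not (j == j') ∧ S i' j')) + 𝟙 ((i' == j) ∧ ((j' == i) ∧ S i' j'))
  nbr-indicator i' j' with S i' j' in s
  ... | false rewrite ∧-zeroʳ (adjI G i j i' j') | ∧-zeroʳ (not (j == j')) | ∧-zeroʳ (i == i')
                    | ∧-zeroʳ (j' == i) | ∧-zeroʳ (i' == j) = refl
  ... | true rewrite ij | S⊆V i' j' s with i ≟ i'
  ...   | no  _    rewrite ∧-identityʳ ((i' == j) ∧ (j' == i)) | ∧-identityʳ (j' == i) = refl
  ...   | yes refl rewrite ==-false i≢j | ∨-identityʳ (not (j == j'))
                         | ∧-identityʳ (not (j == j')) | +-identityʳ (𝟙 (not (j == j'))) = refl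

  nbrs-identity : nbrsInI G S i j + 𝟙 (S i j) ≡ card (S i) + 𝟙 (S j i)
  nbrs-identity = begin
      nbrsInI G S i j + 𝟙 (S i j)
        ≡⟨ cong (_+ 𝟙 (S i j)) (card₂≡sum (λ i' j' → adjI G i j i' j' ∧ S i' j')) ⟩
      ∑[ i' < n ] card (λ j' → adjI G i j i' j' ∧ S i' j') + 𝟙 (S i j)
        ≡⟨ cong (_+ 𝟙 (S i j)) (trans (sum-cong-≗ row-split) (∑-distrib-+ (card ∘ own) (card ∘ back))) ⟩
      ∑[ i' < n ] card (own i') + ∑[ i' < n ] card (back i') + 𝟙 (S i j)
        ≡⟨ cong (λ b → ∑[ i' < n ] card (own i') + b + 𝟙 (S i j)) back-count ⟩
      ∑[ i' < n ] card (own i') + 𝟙 (S j i) + 𝟙 (S i j)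
        ≡⟨ cong (λ a → a + 𝟙 (S j i) + 𝟙 (S i j)) (pick-card (selectsˡ i) (λ i' j' → not (j == j') ∧ S i' j')) ⟩
      card (λ j' → not (j == j') ∧ S i j') + 𝟙 (S j i) + 𝟙 (S i j)
        ≡⟨ xy∙z≈xz∙y _ (𝟙 (S j i)) (𝟙 (S i j)) ⟩
      card (λ j' → not (j == j') ∧ S i j') + 𝟙 (S i j) + 𝟙 (S j i)
        ≡⟨ cong (_+ 𝟙 (S j i)) (≡-sym (card-remove j (S i))) ⟩
      card (S i) + 𝟙 (S j i) ∎
    where
    open ≡-Reasoning
    own back : Fin n → Fin n → Bool
    own  i' j' = (i == i') ∧ (not (j == j') ∧ S i' j')
    back i' j' = (i' == j) ∧ ((j' == i) ∧ S i' j')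

    row-split : ∀ i' → card (λ j' → adjI G i j i' j' ∧ S i' j') ≡ card (own i') + card (back i')
    row-split i' = begin
      card (λ j' → adjI G i j i' j' ∧ S i' j')        ≡⟨ card≡sum (λ j' → adjI G i j i' j' ∧ S i' j') ⟩
      ∑[ j' < n ] 𝟙 (adjI G i j i' j' ∧ S i' j')      ≡⟨ sum-cong-≗ (nbr-indicator i') ⟩
      ∑[ j' < n ] (𝟙 (own i' j') + 𝟙 (back i' j'))    ≡⟨ ∑-distrib-+ (𝟙 ∘ own i') (𝟙 ∘ back i') ⟩
      ∑[ j' < n ] 𝟙 (own i' j') + ∑[ j' < n ] 𝟙 (back i' j')
        ≡⟨ ≡-sym (cong₂ _+_ (card≡sum (own i')) (card≡sum (back i'))) ⟩
      card (own i') + card (back i')                  ∎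

    back-count : ∑[ i' < n ] card (back i') ≡ 𝟙 (S j i)
    back-count = begin
      ∑[ i' < n ] card (back i')            ≡⟨ pick-card (selectsʳ j) (λ i' j' → (j' == i) ∧ S i' j') ⟩
      card (λ j' → (j' == i) ∧ S j j')      ≡⟨ card≡sum (λ j' → (j' == i) ∧ S j j') ⟩
      ∑[ j' < n ] 𝟙 ((j' == i) ∧ S j j')    ≡⟨ pick-𝟙 (selectsʳ i) (S j) ⟩
      𝟙 (S j i)                             ∎

-- Local domination: the inequality that nbrs-identity turns k-tuple total domination into.
LocallyDominating : ∀ {n} → SimpleGraph n → ℕ → (Fin n → Fin n → Bool) → Set
LocallyDominating {n} G k S =
  ∀ (i j : Fin n) → IVertex G i j → k + 𝟙 (S i j) ≤ card (S i) + 𝟙 (S j i)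

module _ {n} (G : SimpleGraph n) (k : ℕ) (S : Fin n → Fin n → Bool) where

  tds⇒local : IsKTupleTDS-I G k S → LocallyDominating G k S
  tds⇒local (S⊆V , dom) i j ij =
    ≤-trans (+-monoˡ-≤ (𝟙 (S i j)) (dom i j ij)) (≤-reflexive (nbrs-identity G S S⊆V ij))

  local⇒tds : IsubsetOK G S → LocallyDominating G k S → IsKTupleTDS-I G k S
  local⇒tds S⊆V local = S⊆V , λ i j ij →
    +-cancelʳ-≤ (𝟙 (S i j)) k _ (≤-trans (local i j ij) (≤-reflexive (≡-sym (nbrs-identity G S S⊆V ij))))

  module _ (local : LocallyDominating G k S) (S⊆V : IsubsetOK G S) where

    -- For k ≥ 2 every clique X_i of a non-isolated x_i holds at least k vertices of S:
    -- local domination at x_i x_j₀ makes S_i nonempty, and then at any x_i x_j ∈ S it gives |S_i| ≥ k.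
    row-≥k : 2 ≤ k → ∀ {i j} → IVertex G i j → k ≤ card (S i)
    row-≥k 2≤k {i} {j₀} ij₀ with card-witness (S i) row-nonempty
      where
      row-nonempty : 1 ≤ card (S i)
      row-nonempty = +-cancelʳ-≤ 1 1 (card (S i))
        (≤-trans 2≤k (≤-trans (m≤m+n k (𝟙 (S i j₀)))
          (≤-trans (local i j₀ ij₀) (+-monoʳ-≤ (card (S i)) (𝟙≤1 (S j₀ i))))))
    ... | j , sij = +-cancelʳ-≤ 1 k (card (S i))
      (≤-trans (≤-reflexive (cong (λ b → k + 𝟙 b) (≡-sym sij)))
               (≤-trans (local i j (S⊆V i j sij)) (+-monoʳ-≤ (card (S i)) (𝟙≤1 (S j i)))))

    reciprocal : ∀ {i j} → card (S i) ≤ k → S i j ≡ true → S j i ≡ true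
    reciprocal {i} {j} small sij with S j i in sji | local i j (S⊆V i j sij)
    ... | true  | _ = refl
    ... | false | bound rewrite sij =
      ⊥-elim (1+n≰n (≤-trans (≤-trans (≤-reflexive (+-comm 1 k)) bound)
                             (≤-trans (≤-reflexive (+-identityʳ (card (S i)))) small)))

<ᵇ-true : ∀ {m n} → m < n → (m <ᵇ n) ≡ true
<ᵇ-true {zero}  {suc n} _         = refl
<ᵇ-true {suc m} {suc n} (s≤s m<n) = <ᵇ-true m<n

<ᵇ-false : ∀ {m n} → n ≤ m → (m <ᵇ n) ≡ false
<ᵇ-false {m}     {zero}  _         = refl
<ᵇ-false {suc m} {suc n} (s≤s n≤m) = <ᵇ-false n≤m

right-<ᵇ : ∀ p b → (p + b <ᵇ p) ≡ false
right-<ᵇ p b = <ᵇ-false (m≤m+n p b)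

+-<ᵇ : ∀ p s k → (p + s <ᵇ p + k) ≡ (s <ᵇ k)
+-<ᵇ zero    s k = refl
+-<ᵇ (suc p) s k = +-<ᵇ p s k

data Side (p : ℕ) : ℕ → Set where
  left  : ∀ {a} → a < p → Side p a
  right : ∀ b → Side p (p + b)

side : ∀ p x → Side p x
side p x with x <? p
... | yes x<p = left x<p
... | no  x≮p = subst (Side p) (m+[n∸m]≡n (≮⇒≥ x≮p)) (right (x ∸ p))

sumBelow : ℕ → (ℕ → ℕ) → ℕ
sumBelow n g = ∑[ i < n ] g (toℕ i)

sumBelow-split : ∀ m n (g : ℕ → ℕ) → sumBelow (m + n) g ≡ sumBelow m g + sumBelow n (λ s → g (m + s))
sumBelow-split m n g = trans (sum-split m (g ∘ toℕ))
  (cong₂ _+_ (sum-cong-≗ {m} (λ i → cong g (toℕ-↑ˡ i n))) (sum-cong-≗ {n} (λ i → cong g (toℕ-↑ʳ m i))))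

sumBelow-cong : ∀ n {f g : ℕ → ℕ} → (∀ s → s < n → f s ≡ g s) → sumBelow n f ≡ sumBelow n g
sumBelow-cong n f≡g = sum-cong-≗ {n} (λ i → f≡g (toℕ i) (toℕ<n i))

sumBelow-const : ∀ n c {f : ℕ → ℕ} → (∀ s → s < n → f s ≡ c) → sumBelow n f ≡ n * c
sumBelow-const n c f≡c = trans (sumBelow-cong n f≡c) (sum-const n c)

sumBelow-zero : ∀ n {f : ℕ → ℕ} → (∀ s → s < n → f s ≡ 0) → sumBelow n f ≡ 0
sumBelow-zero n f≡0 = trans (sumBelow-const n 0 f≡0) (*-zeroʳ n)

count-below : ∀ u m → sumBelow m (λ s → 𝟙 (s <ᵇ u)) ≡ m ⊓ u
count-below zero    m       = trans (sum-zero {m} (λ _ → refl)) (≡-sym (⊓-zeroʳ m))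
count-below (suc u) zero    = refl
count-below (suc u) (suc m) = cong suc (count-below u m)

excess : ∀ {p k t X} → 1 ≤ k → p * k ≤ X → k * t ≤ X → p * k + t ≤ X + p
excess {p} {k} {t} {X} 1≤k pk≤X kt≤X with ≤-total t p
... | inj₁ t≤p = +-mono-≤ pk≤X t≤p
... | inj₂ p≤t = begin
    p * k + t            ≡⟨ cong (p * k +_) (≡-sym (m+[n∸m]≡n p≤t)) ⟩
    p * k + (p + e)      ≡⟨ x∙yz≈xz∙y (p * k) p e ⟩
    (p * k + e) + p      ≤⟨ +-monoˡ-≤ p (+-monoʳ-≤ (p * k) e≤ke) ⟩
    (p * k + k * e) + p  ≡⟨ cong (_+ p) (trans (cong (_+ k * e) (*-comm p k)) (≡-sym (*-distribˡ-+ k p e))) ⟩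
    k * (p + e) + p      ≡⟨ cong (λ s → k * s + p) (m+[n∸m]≡n p≤t) ⟩
    k * t + p            ≤⟨ +-monoˡ-≤ p kt≤X ⟩
    X + p                ∎
  where
  open ≤-Reasoning
  e = t ∸ p
  e≤ke : e ≤ k * e
  e≤ke = ≤-trans (≤-reflexive (≡-sym (*-identityˡ e))) (*-monoˡ-≤ e 1≤k)

lower-arith : ∀ p d k t X Y → 1 ≤ k → p * k ≤ X → k * t ≤ X → (p + d) * (k + 1) ≤ Y + t →
  2 * p * k + d * (k + 1) ≤ X + Y
lower-arith p d k t X Y 1≤k pk≤X kt≤X B-rows = +-cancelʳ-≤ (p + t) _ _ (begin
    2 * p * k + d * (k + 1) + (p + t)  ≡⟨ regroupˡ p d k t ⟩
    (p * k + t) + (p + d) * (k + 1)    ≤⟨ +-mono-≤ (excess 1≤k pk≤X kt≤X) B-rows ⟩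
    (X + p) + (Y + t)                  ≡⟨ regroupʳ X p Y t ⟩
    X + Y + (p + t)                    ∎)
  where
  open ≤-Reasoning
  regroupˡ : ∀ p d k t → 2 * p * k + d * (k + 1) + (p + t) ≡ (p * k + t) + (p + d) * (k + 1)
  regroupˡ = solve-∀
  regroupʳ : ∀ X p Y t → (X + p) + (Y + t) ≡ X + Y + (p + t)
  regroupʳ = solve-∀

module LowerBound (p d k : ℕ) (2≤k : 2 ≤ k) (k<p : k < p)
    (S : Fin (p + (p + d)) → Fin (p + (p + d)) → Bool) (tds : IsKTupleTDS-I (K p (p + d)) k S) where

  private
    q = p + d
    G = K p q
    S⊆V = proj₁ tds
    local = tds⇒local G k S tds

  A : Fin p → Fin (p + q)
  A a = a ↑ˡ q
  B : Fin q → Fin (p + q)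
  B b = p ↑ʳ b

  A-side : ∀ a → (toℕ (A a) <ᵇ p) ≡ true
  A-side a = trans (cong (_<ᵇ p) (toℕ-↑ˡ a q)) (<ᵇ-true (toℕ<n a))

  B-side : ∀ b → (toℕ (B b) <ᵇ p) ≡ false
  B-side b = trans (cong (_<ᵇ p) (toℕ-↑ʳ p b)) (right-<ᵇ p (toℕ b))

  adj-AB : ∀ a b → IVertex G (A a) (B b)
  adj-AB a b = cong₂ _xor_ (A-side a) (B-side b)

  adj-BA : ∀ b a → IVertex G (B b) (A a)
  adj-BA b a = cong₂ _xor_ (B-side b) (A-side a)

  nonadj-BB : ∀ b b' → adj G (B b) (B b') ≡ false
  nonadj-BB b b' = cong₂ _xor_ (B-side b) (B-side b')

  a₀ : Fin p
  a₀ = fromℕ< (≤-trans (s≤s z≤n) k<p)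
  b₀ : Fin q
  b₀ = fromℕ< (≤-trans (≤-trans (s≤s z≤n) k<p) (m≤m+n p d))

  x : Fin p → ℕ
  x a = card (S (A a))
  y : Fin q → ℕ
  y b = card (S (B b))

  small : Fin q → Bool
  small b = isYes (y b ≤? k)
  t : ℕ
  t = ∑[ b < q ] 𝟙 (small b)

  size : cardI S ≡ ∑[ a < p ] x a + ∑[ b < q ] y b
  size = trans (card₂≡sum S) (sum-split p (card ∘ S))

  A-rows : p * k ≤ ∑[ a < p ] x a
  A-rows = ≤-trans (≤-reflexive (≡-sym (sum-const p k)))
                   (sum-mono (λ a → row-≥k G k S local S⊆V 2≤k (adj-AB a b₀)))

  B-rows : q * (k + 1) ≤ ∑[ b < q ] y b + t
  B-rows = ≤-trans (≤-reflexive (≡-sym (sum-const q (k + 1))))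
                   (≤-trans (sum-mono B-row) (≤-reflexive (∑-distrib-+ y (𝟙 ∘ small))))
    where
    B-row : ∀ b → k + 1 ≤ y b + 𝟙 (small b)
    B-row b with y b ≤? k
    ... | yes _   = +-monoˡ-≤ 1 (row-≥k G k S local S⊆V 2≤k (adj-BA b a₀))
    ... | no  big = ≤-trans (≤-reflexive (+-comm k 1)) (≤-trans (≰⇒> big) (m≤m+n (y b) 0))

  -- the S-vertices of a B-clique all face A, since B is independent in K_{p,q}
  B-row-in-A : ∀ b → y b ≡ ∑[ a < p ] 𝟙 (S (B b) (A a))
  B-row-in-A b = begin
      y b                                                              ≡⟨ card≡sum (S (B b)) ⟩
      ∑[ j < p + q ] 𝟙 (S (B b) j)                                     ≡⟨ sum-split p (𝟙 ∘ S (B b)) ⟩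
      ∑[ a < p ] 𝟙 (S (B b) (A a)) + ∑[ b' < q ] 𝟙 (S (B b) (B b'))    ≡⟨ cong (∑[ a < p ] 𝟙 (S (B b) (A a)) +_) (sum-zero outside-V) ⟩
      ∑[ a < p ] 𝟙 (S (B b) (A a)) + 0                                 ≡⟨ +-identityʳ _ ⟩
      ∑[ a < p ] 𝟙 (S (B b) (A a))                                     ∎
    where
    open ≡-Reasoning
    outside-V : ∀ b' → 𝟙 (S (B b) (B b')) ≡ 0
    outside-V b' with S (B b) (B b') in s
    ... | false = refl
    ... | true with trans (≡-sym (S⊆V (B b) (B b') s)) (nonadj-BB b b')
    ...   | ()

  A-row-⊇-B : ∀ a → ∑[ b < q ] 𝟙 (S (A a) (B b)) ≤ x a
  A-row-⊇-B a = ≤-trans (m≤n+m _ _)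
    (≤-reflexive (≡-sym (trans (card≡sum (S (A a))) (sum-split p (𝟙 ∘ S (A a))))))

  -- double counting: each small B-clique has ≥ k S-vertices, all reciprocated inside A-cliques
  double-count : k * t ≤ ∑[ a < p ] x a
  double-count = begin
      k * t                                                ≡⟨ ≡-sym (sum-scale k (𝟙 ∘ small)) ⟩
      ∑[ b < q ] (k * 𝟙 (small b))                         ≤⟨ sum-mono small-row ⟩
      ∑[ b < q ] ∑[ a < p ] 𝟙 (small b ∧ S (B b) (A a))    ≡⟨ ≡-sym (∑-comm (λ a b → 𝟙 (small b ∧ S (B b) (A a)))) ⟩
      ∑[ a < p ] ∑[ b < q ] 𝟙 (small b ∧ S (B b) (A a))    ≤⟨ sum-mono (λ a → ≤-trans (sum-mono (reciprocated a)) (A-row-⊇-B a)) ⟩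
      ∑[ a < p ] x a                                       ∎
    where
    open ≤-Reasoning
    small-row : ∀ b → k * 𝟙 (small b) ≤ ∑[ a < p ] 𝟙 (small b ∧ S (B b) (A a))
    small-row b with y b ≤? k
    ... | yes _ = ≤-trans (≤-reflexive (*-identityʳ k))
                    (≤-trans (row-≥k G k S local S⊆V 2≤k (adj-BA b a₀)) (≤-reflexive (B-row-in-A b)))
    ... | no  _ = ≤-trans (≤-reflexive (*-zeroʳ k)) z≤n
    reciprocated : ∀ a b → 𝟙 (small b ∧ S (B b) (A a)) ≤ 𝟙 (S (A a) (B b))
    reciprocated a b with y b ≤? k | S (B b) (A a) in s
    ... | no  _   | _     = z≤n
    ... | yes _   | false = z≤n
    ... | yes y≤k | true  rewrite reciprocal G k S local S⊆V y≤k s = ≤-refl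

  lower-bound : 2 * p * k + d * (k + 1) ≤ cardI S
  lower-bound = ≤-trans
    (lower-arith p d k t (∑[ a < p ] x a) (∑[ b < q ] y b) (≤-trans (s≤s z≤n) 2≤k) A-rows double-count B-rows)
    (≤-reflexive (≡-sym size))

-- Two ways a vertex x_i x_j meets local domination: a clique with ≥ k vertices of S in which
-- x_i x_j ∈ S is reciprocated, or a clique with ≥ k + 1 vertices of S.
dominated-by-reciprocity : ∀ {k r} {u v : Bool} → k ≤ r → (u ≡ true → v ≡ true) → k + 𝟙 u ≤ r + 𝟙 v
dominated-by-reciprocity {u = false} k≤r _   = +-mono-≤ k≤r z≤n
dominated-by-reciprocity {u = true}  k≤r u⇒v rewrite u⇒v refl = +-mono-≤ k≤r ≤-refl

dominated-by-surplus : ∀ {k r} u v → k + 1 ≤ r → k + 𝟙 u ≤ r + 𝟙 v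
dominated-by-surplus {k} {r} u v k+1≤r =
  ≤-trans (+-monoʳ-≤ k (𝟙≤1 u)) (≤-trans k+1≤r (m≤m+n r (𝟙 v)))

-- Upper bound: an explicit k-tuple total dominating set of (K_{p,p+d})_I of size 2pk + d(k + 1).
-- Vertices of K_{p,p+d} are numbered A = [0, p), B₁ = [p, 2p), B₂ = [2p, 2p + d).
module UpperBound (p d k : ℕ) (k<p : k < p) where

  q : ℕ
  q = p + d

  -- for s < 2p, window s holds iff (s mod p) < k
  window : ℕ → Bool
  window s = (s <ᵇ k) ∨ (not (s <ᵇ p) ∧ (s <ᵇ p + k))

  window-low : ∀ {s} → s < p → window s ≡ (s <ᵇ k)
  window-low {s} s<p rewrite <ᵇ-true s<p = ∨-identityʳ (s <ᵇ k)

  window-high : ∀ s → window (p + s) ≡ (s <ᵇ k)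
  window-high s rewrite <ᵇ-false {p + s} {k} (≤-trans (<⇒≤ k<p) (m≤m+n p s)) | right-<ᵇ p s | +-<ᵇ p s k = refl

  prefix : ℕ → ℕ
  prefix m = sumBelow m (𝟙 ∘ window)

  prefix-low : ∀ {m} → m ≤ p → prefix m ≡ m ⊓ k
  prefix-low {m} m≤p =
    trans (sumBelow-cong m (λ s s<m → cong 𝟙 (window-low (≤-trans s<m m≤p)))) (count-below k m)

  window-count : ∀ {a} → a < p → sumBelow p (λ b → 𝟙 (window (a + b))) ≡ k
  window-count {a} a<p = +-cancelˡ-≡ (prefix a) _ _ (begin
      prefix a + sumBelow p (λ b → 𝟙 (window (a + b)))  ≡⟨ ≡-sym (sumBelow-split a p (𝟙 ∘ window)) ⟩
      prefix (a + p)                                    ≡⟨ cong prefix (+-comm a p) ⟩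
      prefix (p + a)                                    ≡⟨ sumBelow-split p a (𝟙 ∘ window) ⟩
      prefix p + sumBelow a (λ s → 𝟙 (window (p + s)))
        ≡⟨ cong₂ _+_ (prefix-low ≤-refl) (sumBelow-cong a (λ s _ → cong 𝟙 (window-high s))) ⟩
      p ⊓ k + sumBelow a (λ s → 𝟙 (s <ᵇ k))            ≡⟨ cong₂ _+_ (m≥n⇒m⊓n≡n (<⇒≤ k<p)) (count-below k a) ⟩
      k + a ⊓ k                                         ≡⟨ +-comm k (a ⊓ k) ⟩
      a ⊓ k + k                                         ≡⟨ cong (_+ k) (≡-sym (prefix-low (<⇒≤ a<p))) ⟩
      prefix a + k                                      ∎)
    where open ≡-Reasoning

  -- a ∈ A and p + b ∈ B₁ are linked (in both cliques) when (a + b) mod p < k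
  link : ℕ → ℕ → Bool
  link a b = (b <ᵇ p) ∧ window (a + b)

  -- T x y: whether the vertex x_x x_y of the inflated graph is chosen; the cliques of B₂
  -- additionally choose their vertices facing 0, …, k
  T : ℕ → ℕ → Bool
  T x y = if x <ᵇ p then not (y <ᵇ p) ∧ link x (y ∸ p)
          else (y <ᵇ p) ∧ (link y (x ∸ p) ∨ (not ((x ∸ p) <ᵇ p) ∧ (y <ᵇ suc k)))

  T-AA : ∀ {a a'} → a < p → a' < p → T a a' ≡ false
  T-AA a<p a'<p rewrite <ᵇ-true a<p | <ᵇ-true a'<p = refl

  T-AB : ∀ {a} b → a < p → T a (p + b) ≡ link a b
  T-AB {a} b a<p rewrite <ᵇ-true a<p | right-<ᵇ p b | m+n∸m≡n p b = refl

  T-BA : ∀ {a} b → a < p → T (p + b) a ≡ link a b ∨ (not (b <ᵇ p) ∧ (a <ᵇ suc k))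
  T-BA {a} b a<p rewrite <ᵇ-true a<p | right-<ᵇ p b | m+n∸m≡n p b = refl

  T-BB : ∀ b b' → T (p + b) (p + b') ≡ false
  T-BB b b' rewrite right-<ᵇ p b | right-<ᵇ p b' = refl

  T-B₁-sym : ∀ {a b} → a < p → b < p → T (p + b) a ≡ T a (p + b)
  T-B₁-sym {a} {b} a<p b<p rewrite T-BA b a<p | T-AB b a<p | <ᵇ-true b<p = ∨-identityʳ (window (a + b))

  row : ℕ → ℕ
  row x = sumBelow (p + q) (λ y → 𝟙 (T x y))

  row-A : ∀ {a} → a < p → row a ≡ k
  row-A {a} a<p = begin
      row a
        ≡⟨ sumBelow-split p q (λ y → 𝟙 (T a y)) ⟩
      sumBelow p (λ y → 𝟙 (T a y)) + sumBelow (p + d) (λ b → 𝟙 (T a (p + b)))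
        ≡⟨ cong₂ _+_ (sumBelow-zero p (λ y y<p → cong 𝟙 (T-AA a<p y<p)))
                     (sumBelow-cong q (λ b _ → cong 𝟙 (T-AB b a<p))) ⟩
      0 + sumBelow (p + d) (λ b → 𝟙 (link a b))
        ≡⟨ sumBelow-split p d (λ b → 𝟙 (link a b)) ⟩
      sumBelow p (λ b → 𝟙 (link a b)) + sumBelow d (λ c → 𝟙 (link a (p + c)))
        ≡⟨ cong₂ _+_ (sumBelow-cong p (λ b b<p → cong (λ u → 𝟙 (u ∧ window (a + b))) (<ᵇ-true b<p)))
                     (sumBelow-zero d (λ c _ → cong (λ u → 𝟙 (u ∧ window (a + (p + c)))) (right-<ᵇ p c))) ⟩
      sumBelow p (λ b → 𝟙 (window (a + b))) + 0
        ≡⟨ +-identityʳ _ ⟩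
      sumBelow p (λ b → 𝟙 (window (a + b)))
        ≡⟨ window-count a<p ⟩
      k ∎
    where open ≡-Reasoning

  row-B : ∀ b → row (p + b) ≡ sumBelow p (λ a → 𝟙 (T (p + b) a))
  row-B b = begin
      row (p + b)
        ≡⟨ sumBelow-split p q (λ y → 𝟙 (T (p + b) y)) ⟩
      sumBelow p (λ a → 𝟙 (T (p + b) a)) + sumBelow q (λ b' → 𝟙 (T (p + b) (p + b')))
        ≡⟨ cong (sumBelow p (λ a → 𝟙 (T (p + b) a)) +_) (sumBelow-zero q (λ b' _ → cong 𝟙 (T-BB b b'))) ⟩
      sumBelow p (λ a → 𝟙 (T (p + b) a)) + 0
        ≡⟨ +-identityʳ _ ⟩
      sumBelow p (λ a → 𝟙 (T (p + b) a)) ∎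
    where open ≡-Reasoning

  row-B₁ : ∀ {b} → b < p → row (p + b) ≡ k
  row-B₁ {b} b<p = trans (row-B b) (trans (sumBelow-cong p as-window) (window-count b<p))
    where
    as-window : ∀ a → a < p → 𝟙 (T (p + b) a) ≡ 𝟙 (window (b + a))
    as-window a a<p rewrite T-B₁-sym a<p b<p | T-AB b a<p | <ᵇ-true b<p | +-comm a b = refl

  row-B₂ : ∀ c → row (p + (p + c)) ≡ k + 1
  row-B₂ c = begin
      row (p + (p + c))                          ≡⟨ row-B (p + c) ⟩
      sumBelow p (λ a → 𝟙 (T (p + (p + c)) a))   ≡⟨ sumBelow-cong p facing-0…k ⟩
      sumBelow p (λ a → 𝟙 (a <ᵇ suc k))          ≡⟨ count-below (suc k) p ⟩
      p ⊓ suc k                                  ≡⟨ m≥n⇒m⊓n≡n k<p ⟩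
      suc k                                      ≡⟨ +-comm 1 k ⟩
      k + 1                                      ∎
    where
    open ≡-Reasoning
    facing-0…k : ∀ a → a < p → 𝟙 (T (p + (p + c)) a) ≡ 𝟙 (a <ᵇ suc k)
    facing-0…k a a<p rewrite T-BA (p + c) a<p | right-<ᵇ p c = refl

  total : sumBelow (p + q) row ≡ 2 * p * k + d * (k + 1)
  total = begin
      sumBelow (p + q) row
        ≡⟨ sumBelow-split p q row ⟩
      sumBelow p row + sumBelow (p + d) (λ b → row (p + b))
        ≡⟨ cong (sumBelow p row +_) (sumBelow-split p d (λ b → row (p + b))) ⟩
      sumBelow p row + (sumBelow p (λ b → row (p + b)) + sumBelow d (λ c → row (p + (p + c))))
        ≡⟨ cong₂ (λ u v → u + (v + sumBelow d (λ c → row (p + (p + c)))))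
                 (sumBelow-const p k (λ a → row-A)) (sumBelow-const p k (λ b → row-B₁)) ⟩
      p * k + (p * k + sumBelow d (λ c → row (p + (p + c))))
        ≡⟨ cong (λ u → p * k + (p * k + u)) (sumBelow-const d (k + 1) (λ c _ → row-B₂ c)) ⟩
      p * k + (p * k + d * (k + 1))
        ≡⟨ regroup p k d ⟩
      2 * p * k + d * (k + 1) ∎
    where
    open ≡-Reasoning
    regroup : ∀ p k d → p * k + (p * k + d * (k + 1)) ≡ 2 * p * k + d * (k + 1)
    regroup = solve-∀

  T-local : ∀ x y → ((x <ᵇ p) xor (y <ᵇ p)) ≡ true → k + 𝟙 (T x y) ≤ row x + 𝟙 (T y x)
  T-local x y edge with side p x | side p y
  T-local _ _ edge | left a<p | left a'<p rewrite <ᵇ-true a<p | <ᵇ-true a'<p with edge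
  ... | ()
  T-local _ _ edge | right b | right b' rewrite right-<ᵇ p b | right-<ᵇ p b' with edge
  ... | ()
  T-local _ _ _ | left {a} a<p | right b rewrite T-AB b a<p | T-BA b a<p =
    dominated-by-reciprocity (≤-reflexive (≡-sym (row-A a<p))) (cong (_∨ (not (b <ᵇ p) ∧ (a <ᵇ suc k))))
  T-local _ _ _ | right b | left {a} a<p with side p b
  ... | left b<p = dominated-by-reciprocity (≤-reflexive (≡-sym (row-B₁ b<p)))
                     (trans (≡-sym (T-B₁-sym a<p b<p)))
  ... | right c  = dominated-by-surplus (T (p + (p + c)) a) (T a (p + (p + c))) (≤-reflexive (≡-sym (row-B₂ c)))

  S : Fin (p + q) → Fin (p + q) → Bool
  S i j = T (toℕ i) (toℕ j)

  S-row : ∀ i → card (S i) ≡ row (toℕ i)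
  S-row i = card≡sum (S i)

  S-size : cardI S ≡ 2 * p * k + d * (k + 1)
  S-size = trans (card₂≡sum S) (trans (sum-cong-≗ S-row) total)

  S⊆V : IsubsetOK (K p q) S
  S⊆V i j = sides-differ (toℕ i) (toℕ j)
    where
    sides-differ : ∀ x y → T x y ≡ true → ((x <ᵇ p) xor (y <ᵇ p)) ≡ true
    sides-differ x y Txy with x <ᵇ p | y <ᵇ p
    ... | true  | false = refl
    ... | false | true  = refl
    ... | true  | true  = Txy
    ... | false | false = Txy

  S-tds : IsKTupleTDS-I (K p q) k S
  S-tds = local⇒tds (K p q) k S S⊆V local
    where
    local : LocallyDominating (K p q) k S
    local i j edge rewrite S-row i = T-local (toℕ i) (toℕ j) edge

γ×t-I-K : ∀ p d k → 2 ≤ k → k < p → γ×t-I≡ (K p (p + d)) k (2 * p * k + d * (k + 1))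
γ×t-I-K p d k 2≤k k<p =
  (S , S-tds , S-size) , λ S' tds' → LowerBound.lower-bound p d k 2≤k k<p S' tds'
  where open UpperBound p d k k<p using (S; S-tds; S-size)

proposition4p4 : (p q k : ℕ) → 2 ≤ k → k < p → p ≤ q →
    γ×t-I≡ (K p q) k (2 * p * k + (q ∸ p) * (k + 1))
proposition4p4 p q k 2≤k k<p p≤q =
  subst (λ q' → γ×t-I≡ (K p q') k (2 * p * k + (q' ∸ p) * (k + 1))) (m+[n∸m]≡n p≤q)
    (subst (λ e → γ×t-I≡ (K p (p + d)) k (2 * p * k + e * (k + 1))) (≡-sym (m+n∸m≡n p d))
      (γ×t-I-K p d k 2≤k k<p))
  where d = q ∸ p
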